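{- Let $q$ be a prime power and let $C$ be a linear completely regular code of length $n$ over $GF(q)$. Then the quotient graph $H(n,q)/\Delta(C)$ is never isomorphic to a Doob graph.
   Context: $H(n,q)$ has vertex set $GF(q)^n$, two words adjacent iff they differ in exactly one coordinate. A linear code is a subspace $C\le GF(q)^n$; $\Delta(C)=\{C+x\}$ is its coset partition and $H(n,q)/\Delta(C)$ is the graph on the cosets, two distinct cosets adjacent iff some edge of $H(n,q)$ joins them. For a code $C$, $C_i$ is the set of vertices at distance $i$ from $C$ and $\rho$ the largest $i$ with $C_i\neq\emptyset$; $C$ is completely regular if $\{C_0,\dots,C_\rho\}$ is an equitable partition. A Doob graph is the cartesian product of some number of complete graphs $K_4$ and at least one Shrikhande graph (the Cayley graph on $\mathbb{Z}_4^2$ with connection set $\{\pm(1,0),\pm(0,1),\pm(1,1)\}$). -}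

module Defs where

open import Level using (0ℓ)
open import Algebra.Bundles using (CommutativeRing)
open import Data.Nat using (ℕ; zero; suc; _⊓_; _%_; _∸_)
open import Data.Fin using (Fin; toℕ)
open import Data.Vec using (Vec; []; _∷_; zipWith; replicate; map; lookup; _[_]≔_)
open import Data.List as L using (List; []; _∷_; concatMap; filter; length; foldr)
open import Data.List.Membership.Propositional using (_∈_)
open import Data.List.Relation.Unary.Unique.Propositional using (Unique)
open import Data.Product using (Σ; ∃; _×_; _,_)
open import Data.Sum using (_⊎_)
open import Data.Bool using (true; false)
open import Function.Bundles using (_⇔_)
open import Relation.Nullary using (¬_; Dec; does)
open import Relation.Nullary.Decidable using (_×-dec_)
open import Relation.Unary using (Pred; Decidable)
open import Relation.Binary.PropositionalEquality using (_≡_; _≢_)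
import Data.Nat as ℕ
import Data.Fin as F

-- Finite fields.  GF(q) (q a prime power) ranges exactly over the finite
-- fields (up to isomorphism); q = length elements.

record FiniteField : Set₁ where
  field
    commRing : CommutativeRing 0ℓ 0ℓ
  open CommutativeRing commRing public
  field
    ≈⇒≡      : ∀ {x y} → x ≈ y → x ≡ y
    _≟_      : (x y : Carrier) → Dec (x ≡ y)
    0≢1      : 0# ≢ 1#
    inverse  : ∀ x → x ≢ 0# → Σ Carrier λ y → x * y ≡ 1#
    elements : List Carrier
    complete : ∀ x → x ∈ elements
    unique   : Unique elements

module _ (F : FiniteField) where
  open FiniteField F

  Word : ℕ → Set
  Word n = Vec Carrier n

  allWords : (n : ℕ) → List (Word n)
  allWords zero    = [] ∷ []
  allWords (suc n) = concatMap (λ a → L.map (a ∷_) (allWords n)) elements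

  _⊕_ : ∀ {n} → Word n → Word n → Word n
  _⊕_ = zipWith _+_

  _⊖_ : ∀ {n} → Word n → Word n → Word n
  x ⊖ y = zipWith (λ a b → a + (- b)) x y

  zeroW : ∀ {n} → Word n
  zeroW = replicate _ 0#

  scale : ∀ {n} → Carrier → Word n → Word n
  scale a = map (a *_)

  dist : ∀ {n} → Word n → Word n → ℕ
  dist []       []       = 0
  dist (a ∷ x) (b ∷ y) = (if? (a ≟ b)) ℕ.+ dist x y
    where
    if? : Dec (a ≡ b) → ℕ
    if? d with does d
    ... | true  = 0
    ... | false = 1

  HAdj : ∀ {n} → Word n → Word n → Set
  HAdj x y = dist x y ≡ 1

  record LinearCode (n : ℕ) : Set₁ where
    field
      _∈C   : Pred (Word n) 0ℓ
      ∈C?   : Decidable _∈C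
      0∈C   : zeroW ∈C
      +∈C   : ∀ {x y} → x ∈C → y ∈C → (x ⊕ y) ∈C
      ·∈C   : ∀ a {x} → x ∈C → scale a x ∈C

  module _ {n : ℕ} (C : LinearCode n) where
    open LinearCode C

    codewords : List (Word n)
    codewords = filter ∈C? (allWords n)

    -- d(x,C) = min over codewords c of dist(x,c)   (every distance is ≤ n)
    distC : Word n → ℕ
    distC x = foldr _⊓_ n (L.map (dist x) codewords)

    nbrCount : Word n → ℕ → ℕ
    nbrCount x j =
      length (filter (λ y → (dist x y ℕ.≟ 1) ×-dec (distC y ℕ.≟ j)) (allWords n))

    -- {C_0,…,C_ρ} is an equitable partition: the number of neighbours in C_j
    -- of a vertex in C_i depends only on i and j.
    CompletelyRegular : Set
    CompletelyRegular =
      ∀ (x y : Word n) (j : ℕ) → distC x ≡ distC y → nbrCount x j ≡ nbrCount y j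

-- Shrikhande graph: Cayley graph on ℤ₄² with connection set
-- {±(1,0), ±(0,1), ±(1,1)}
ShrVertex : Set
ShrVertex = Fin 4 × Fin 4

sub4 : Fin 4 → Fin 4 → ℕ
sub4 a b = (toℕ a ℕ.+ 4 ∸ toℕ b) % 4

ShrAdj : ShrVertex → ShrVertex → Set
ShrAdj (a , b) (c , d) = (sub4 c a , sub4 d b) ∈ conn
  where
  conn : List (ℕ × ℕ)
  conn = (1 , 0) ∷ (3 , 0) ∷ (0 , 1) ∷ (0 , 3) ∷ (1 , 1) ∷ (3 , 3) ∷ []

-- vertex set of the cartesian product of m Shrikhande graphs and k copies of K₄
DoobVertex : ℕ → ℕ → Set
DoobVertex m k = Vec ShrVertex m × Vec (Fin 4) k

DoobAdj : ∀ {m k} → DoobVertex m k → DoobVertex m k → Set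
DoobAdj {m} {k} (s , t) (s' , t') =
  (Σ (Fin m) λ i → ShrAdj (lookup s i) (lookup s' i)
                   × s' ≡ (s [ i ]≔ lookup s' i) × t' ≡ t)
  ⊎
  (Σ (Fin k) λ i → lookup t i ≢ lookup t' i
                   × t' ≡ (t [ i ]≔ lookup t' i) × s' ≡ s)

-- H(n,q)/Δ(C) ≅ D(m,k): a map f from words onto Doob vertices whose fibres
-- are exactly the cosets C + x (so f induces a bijection Δ(C) → V(D)), such
-- that two cosets are adjacent in the quotient graph iff their images are
-- adjacent in the Doob graph.

module _ (F : FiniteField) where
  open FiniteField F

  QuotientIsoDoob : ∀ {n} → LinearCode F n → (m k : ℕ) → Set
  QuotientIsoDoob {n} C m k =
    Σ (Word F n → DoobVertex m k) λ f →
      (∀ x y → (f x ≡ f y) ⇔ ((_⊖_ F x y) ∈C))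
      × (∀ v → ∃ λ x → f x ≡ v)
      × (∀ x y → DoobAdj (f x) (f y) ⇔
           ((¬ ((_⊖_ F x y) ∈C)) ×
            (Σ (Word F n) λ x' → Σ (Word F n) λ y' →
               ((_⊖_ F x x') ∈C) × ((_⊖_ F y y') ∈C) × HAdj F x' y')))
    where open LinearCode C

module Submission where

-- The quotient graph inherits many automorphisms from GF(q)^n: every affine map
-- z ↦ q + μ(z − p) with μ ≠ 0 is an isometry of H(n,q) mapping cosets of C to
-- cosets of C.  Transport them along an isomorphism f onto a Doob graph D(m,k)
-- (m ≥ 1) and look at the base edge between the vertices s₀ = (0,0) and
-- s₁ = (1,0) of the first Shrikhande factor.
--  * Characteristic 2: the translation by (a representative of) s₁ − s₀ swaps
--    s₀ and s₁ and moves every vertex to a neighbour, so it maps a common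
--    neighbour of the base edge to an adjacent common neighbour.  But the two
--    common neighbours of an edge of the Shrikhande graph are not adjacent.
--  * Odd characteristic: the point reflection ρ in s₀ is an automorphism fixing
--    s₀, and since 2 is invertible every neighbour z of s₀ is adjacent to ρ z.
--    So ρ s₁ is a common neighbour w of the base edge; a suitable neighbour g of
--    s₀ and w is then forced to satisfy ρ g = ρ s₁, i.e. g = s₁, which is false.

open import Level using (0ℓ)
open import Defs
open import Algebra.Bundles using (CommutativeRing)
import Algebra.Properties.Ring as RingProperties
import Algebra.Properties.AbelianGroup as AbelianGroupProperties
import Algebra.Properties.CommutativeSemigroup as CommutativeSemigroupProperties
import Relation.Binary.Reasoning.Setoid as SetoidReasoning
open import Data.Nat as ℕ using (ℕ; suc; _≤_; s≤s)
open import Data.Fin as Fin using (Fin)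
open import Data.Fin.Properties using (all?; any?)
open import Data.Vec using (Vec; []; _∷_; replicate; lookup)
import Data.Vec.Properties as Vec
open import Data.List.Membership.DecPropositional as ListMembership using ()
open import Data.Product using (Σ; ∃; _×_; _,_; proj₁; proj₂; uncurry)
open import Data.Product.Properties using (≡-dec)
open import Data.Sum using (_⊎_; inj₁; inj₂)
open import Data.Empty using (⊥; ⊥-elim)
open import Function.Bundles using (_⇔_; Equivalence)
open import Relation.Nullary using (¬_; Dec; yes; no; ¬?)
open import Relation.Nullary.Decidable using (from-yes; _×-dec_; _→-dec_; map′)
open import Relation.Binary.PropositionalEquality
  using (_≡_; _≢_; refl; sym; trans; cong; cong₂; subst; subst₂; module ≡-Reasoning)

_≟ᵥ_ : (u v : ShrVertex) → Dec (u ≡ v)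
_≟ᵥ_ = ≡-dec Fin._≟_ Fin._≟_

shrAdj? : ∀ u v → Dec (ShrAdj u v)
shrAdj? (a , b) (c , d) = ListMembership._∈?_ (≡-dec ℕ._≟_ ℕ._≟_) (sub4 c a , sub4 d b) _

allVertices? : {P : ShrVertex → Set} → (∀ v → Dec (P v)) → Dec (∀ v → P v)
allVertices? P? =
  map′ uncurry (λ ∀P a b → ∀P (a , b)) (all? λ a → all? λ b → P? (a , b))

someVertex? : {P : ShrVertex → Set} → (∀ v → Dec (P v)) → Dec (∃ P)
someVertex? P? =
  map′ (λ { (a , b , p) → (a , b) , p }) (λ { ((a , b) , p) → a , b , p })
       (any? λ a → any? λ b → P? (a , b))

shrAdj-irrefl : ∀ v → ¬ ShrAdj v v
shrAdj-irrefl = from-yes (allVertices? λ v → ¬? (shrAdj? v v))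

s₀ s₁ : ShrVertex
s₀ = Fin.zero , Fin.zero
s₁ = Fin.suc Fin.zero , Fin.zero

base-edge : ShrAdj s₀ s₁
base-edge = from-yes (shrAdj? s₀ s₁)

base-edge⁻¹ : ShrAdj s₁ s₀
base-edge⁻¹ = from-yes (shrAdj? s₁ s₀)

-- common neighbours of the base edge (there are two: (1,1) and (0,3))
EdgeCommon : ShrVertex → Set
EdgeCommon h = ShrAdj s₀ h × ShrAdj s₁ h

edgeCommon? : ∀ h → Dec (EdgeCommon h)
edgeCommon? h = shrAdj? s₀ h ×-dec shrAdj? s₁ h

some-edge-common : ∃ EdgeCommon
some-edge-common = from-yes (someVertex? edgeCommon?)

edge-common-independent : ∀ h h' → EdgeCommon h → EdgeCommon h' → ¬ ShrAdj h h'
edge-common-independent = from-yes (allVertices? λ h → allVertices? λ h' →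
  edgeCommon? h →-dec (edgeCommon? h' →-dec ¬? (shrAdj? h h')))

Pivot : ShrVertex → Set
Pivot w = Σ ShrVertex λ g → ShrAdj s₀ g × ShrAdj g s₀ × ShrAdj w g × g ≢ s₁ ×
  (∀ w' → EdgeCommon w' → ShrAdj g w' → w' ≡ w)

pivot? : ∀ w → Dec (Pivot w)
pivot? w = someVertex? λ g →
  shrAdj? s₀ g ×-dec shrAdj? g s₀ ×-dec shrAdj? w g ×-dec ¬? (g ≟ᵥ s₁) ×-dec
  allVertices? λ w' → edgeCommon? w' →-dec (shrAdj? g w' →-dec (w' ≟ᵥ w))

pivot : ∀ w → EdgeCommon w → Pivot w
pivot = from-yes (allVertices? λ w → edgeCommon? w →-dec pivot? w)

doobAdj-irrefl : ∀ {m k} (v : DoobVertex m k) → ¬ DoobAdj v v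
doobAdj-irrefl (s , t) (inj₁ (i , s~s , _)) = shrAdj-irrefl (lookup s i) s~s
doobAdj-irrefl (s , t) (inj₂ (i , t≢t , _)) = t≢t refl

axis : ∀ {m k} → ShrVertex → DoobVertex (suc m) k
axis h = h ∷ replicate _ s₀ , replicate _ Fin.zero

axis-injective : ∀ {m k} {a b : ShrVertex} → axis {m} {k} a ≡ axis b → a ≡ b
axis-injective e = proj₁ (Vec.∷-injective (cong proj₁ e))

axis-adj : ∀ {m k} {a b} → ShrAdj a b → DoobAdj (axis {m} {k} a) (axis b)
axis-adj a~b = inj₁ (Fin.zero , a~b , refl , refl)

neighbour-of-axis : ∀ {m k} a h (s : Vec ShrVertex m) (t : Vec (Fin 4) k) →
  DoobAdj (axis a) (h ∷ s , t) → (ShrAdj a h × (h ∷ s , t) ≡ axis h) ⊎ h ≡ a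
neighbour-of-axis a h s t (inj₁ (Fin.zero , a~h , es , et)) =
  inj₁ (a~h , cong₂ _,_ (cong (h ∷_) (proj₂ (Vec.∷-injective es))) et)
neighbour-of-axis a h s t (inj₁ (Fin.suc i , _ , es , _)) = inj₂ (proj₁ (Vec.∷-injective es))
neighbour-of-axis a h s t (inj₂ (i , _ , _ , es)) = inj₂ (proj₁ (Vec.∷-injective es))

axis-adj⁻¹ : ∀ {m k} {a b} → DoobAdj (axis {m} {k} a) (axis b) → ShrAdj a b
axis-adj⁻¹ {a = a} {b} a~b with neighbour-of-axis a b _ _ a~b
... | inj₁ (a~b' , _) = a~b'
... | inj₂ refl       = ⊥-elim (doobAdj-irrefl _ a~b)

common-neighbour-on-axis : ∀ {m k} {a b} → ShrAdj a b → (v : DoobVertex (suc m) k) →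
  DoobAdj (axis a) v → DoobAdj (axis b) v →
  Σ ShrVertex λ h → v ≡ axis h × ShrAdj a h × ShrAdj b h
common-neighbour-on-axis {a = a} {b} a~b (h ∷ s , t) a~v b~v
  with neighbour-of-axis a h s t a~v | neighbour-of-axis b h s t b~v
... | inj₁ (a~h , v≡h) | inj₁ (b~h , _) = h , v≡h , a~h , b~h
... | inj₁ (_ , v≡h)   | inj₂ refl      = ⊥-elim (doobAdj-irrefl _ (subst (DoobAdj (axis h)) v≡h b~v))
... | inj₂ refl        | inj₁ (_ , v≡h) = ⊥-elim (doobAdj-irrefl _ (subst (DoobAdj (axis h)) v≡h a~v))
... | inj₂ refl        | inj₂ refl      = ⊥-elim (shrAdj-irrefl h a~b)

module RingIdentities (R : CommutativeRing 0ℓ 0ℓ) where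
  open CommutativeRing R hiding (refl; sym) renaming (trans to ≈-trans)
  open RingProperties ring using (-‿distribʳ-*; -1*x≈-x)
  open AbelianGroupProperties +-abelianGroup
    using (⁻¹-∙-comm; ⁻¹-anti-homo‿-; ⁻¹-involutive; xyx⁻¹≈y; x∙y⁻¹≈ε⇒x≈y; inverseʳ-unique)
  open CommutativeSemigroupProperties +-commutativeSemigroup using (interchange; x∙yz≈y∙xz)
  open SetoidReasoning setoid

  two : Carrier
  two = 1# + 1#

  difference-of-sums : ∀ a b c d → (a + b) + - (c + d) ≈ (a + - c) + (b + - d)
  difference-of-sums a b c d = begin
    (a + b) + - (c + d)    ≈⟨ +-congˡ (⁻¹-∙-comm c d) ⟨
    (a + b) + (- c + - d)  ≈⟨ interchange a b (- c) (- d) ⟩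
    (a + - c) + (b + - d)  ∎

  cancel-common-summand : ∀ q u v → (q + u) + - (q + v) ≈ u + - v
  cancel-common-summand q u v = begin
    (q + u) + - (q + v)    ≈⟨ difference-of-sums q u q v ⟩
    (q + - q) + (u + - v)  ≈⟨ +-congʳ (-‿inverseʳ q) ⟩
    0# + (u + - v)         ≈⟨ +-identityˡ _ ⟩
    u + - v                ∎

  cancel-common-subtrahend : ∀ p u v → (u + - p) + - (v + - p) ≈ u + - v
  cancel-common-subtrahend p u v = begin
    (u + - p) + - (v + - p)    ≈⟨ difference-of-sums u (- p) v (- p) ⟩
    (u + - v) + (- p + - - p)  ≈⟨ +-congˡ (-‿inverseʳ (- p)) ⟩
    (u + - v) + 0#             ≈⟨ +-identityʳ _ ⟩
    u + - v                    ∎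

  minus-one-squared : - 1# * - 1# ≈ 1#
  minus-one-squared = ≈-trans (-1*x≈-x (- 1#)) (⁻¹-involutive 1#)

  affine-difference : ∀ p q μ a b →
    (q + μ * (a + - p)) + - (q + μ * (b + - p)) ≈ μ * (a + - b)
  affine-difference p q μ a b = begin
    (q + μ * (a + - p)) + - (q + μ * (b + - p))  ≈⟨ cancel-common-summand q _ _ ⟩
    μ * (a + - p) + - (μ * (b + - p))            ≈⟨ +-congˡ (-‿distribʳ-* μ _) ⟩
    μ * (a + - p) + μ * - (b + - p)              ≈⟨ distribˡ μ _ _ ⟨
    μ * ((a + - p) + - (b + - p))                ≈⟨ *-congˡ (cancel-common-subtrahend p a b) ⟩
    μ * (a + - b)                                ∎

  affine-sends : ∀ p q μ → q + μ * (p + - p) ≈ q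
  affine-sends p q μ = begin
    q + μ * (p + - p)  ≈⟨ +-congˡ (*-congˡ (-‿inverseʳ p)) ⟩
    q + μ * 0#         ≈⟨ +-congˡ (zeroʳ μ) ⟩
    q + 0#             ≈⟨ +-identityʳ q ⟩
    q                  ∎

  cancel-unit : ∀ {μ μ'} → μ * μ' ≈ 1# → ∀ w → μ' * (μ * w) ≈ w
  cancel-unit {μ} {μ'} μμ'≈1 w = begin
    μ' * (μ * w)  ≈⟨ *-assoc μ' μ w ⟨
    (μ' * μ) * w  ≈⟨ *-congʳ (≈-trans (*-comm μ' μ) μμ'≈1) ⟩
    1# * w        ≈⟨ *-identityˡ w ⟩
    w             ∎

  affine-injective : ∀ {μ μ'} → μ * μ' ≈ 1# → ∀ p q a b →
    q + μ * (a + - p) ≈ q + μ * (b + - p) → a ≈ b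
  affine-injective {μ} {μ'} μμ'≈1 p q a b images≈ = x∙y⁻¹≈ε⇒x≈y a b (begin
    a + - b                                              ≈⟨ cancel-unit μμ'≈1 _ ⟨
    μ' * (μ * (a + - b))                                 ≈⟨ *-congˡ (affine-difference p q μ a b) ⟨
    μ' * ((q + μ * (a + - p)) + - (q + μ * (b + - p)))  ≈⟨ *-congˡ (+-congʳ images≈) ⟩
    μ' * ((q + μ * (b + - p)) + - (q + μ * (b + - p)))  ≈⟨ *-congˡ (-‿inverseʳ _) ⟩
    μ' * 0#                                              ≈⟨ zeroʳ μ' ⟩
    0#                                                   ∎)

  translations-commute : ∀ x y t → t + 1# * (y + - x) ≈ y + 1# * (t + - x)
  translations-commute x y t = begin
    t + 1# * (y + - x)  ≈⟨ +-congˡ (*-identityˡ _) ⟩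
    t + (y + - x)       ≈⟨ x∙yz≈y∙xz t y (- x) ⟩
    y + (t + - x)       ≈⟨ +-congˡ (*-identityˡ _) ⟨
    y + 1# * (t + - x)  ∎

  characteristic-two-swap : two ≈ 0# → ∀ x y → y + 1# * (y + - x) ≈ x
  characteristic-two-swap two≈0 x y = begin
    y + 1# * (y + - x)  ≈⟨ +-congˡ (*-identityˡ _) ⟩
    y + (y + - x)       ≈⟨ +-assoc y y (- x) ⟨
    (y + y) + - x       ≈⟨ +-congʳ (double≈0 y) ⟩
    0# + - x            ≈⟨ +-identityˡ (- x) ⟩
    - x                 ≈⟨ inverseʳ-unique x x (double≈0 x) ⟨
    x                   ∎
    where
    double≈0 : ∀ z → z + z ≈ 0#
    double≈0 z = begin
      z + z              ≈⟨ +-cong (*-identityˡ z) (*-identityˡ z) ⟨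
      1# * z + 1# * z    ≈⟨ distribʳ z 1# 1# ⟨
      two * z            ≈⟨ *-congʳ two≈0 ⟩
      0# * z             ≈⟨ zeroˡ z ⟩
      0#                 ∎

  reflection-involutive : ∀ x y → x + - 1# * ((x + - 1# * (y + - x)) + - x) ≈ y
  reflection-involutive x y = begin
    x + - 1# * ((x + - 1# * (y + - x)) + - x)  ≈⟨ +-congˡ (*-congˡ (xyx⁻¹≈y x _)) ⟩
    x + - 1# * (- 1# * (y + - x))              ≈⟨ +-congˡ (-1*x≈-x _) ⟩
    x + - (- 1# * (y + - x))                   ≈⟨ +-congˡ (-‿cong (-1*x≈-x _)) ⟩
    x + - - (y + - x)                          ≈⟨ +-congˡ (⁻¹-involutive _) ⟩
    x + (y + - x)                              ≈⟨ x∙yz≈y∙xz x y (- x) ⟩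
    y + (x + - x)                              ≈⟨ +-congˡ (-‿inverseʳ x) ⟩
    y + 0#                                     ≈⟨ +-identityʳ y ⟩
    y                                          ∎

  homothety-two : ∀ x z → z + two * (x + - z) ≈ x + - 1# * (z + - x)
  homothety-two x z = begin
    z + two * (x + - z)          ≈⟨ +-congˡ (distribʳ _ 1# 1#) ⟩
    z + (1# * d + 1# * d)        ≈⟨ +-congˡ (+-cong (*-identityˡ d) (*-identityˡ d)) ⟩
    z + (d + d)                  ≈⟨ +-assoc z d d ⟨
    (z + d) + d                  ≈⟨ +-congʳ (x∙yz≈y∙xz z x (- z)) ⟩
    (x + (z + - z)) + d          ≈⟨ +-congʳ (+-congˡ (-‿inverseʳ z)) ⟩
    (x + 0#) + d                 ≈⟨ +-congʳ (+-identityʳ x) ⟩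
    x + d                        ≈⟨ +-congˡ (⁻¹-anti-homo‿- z x) ⟨
    x + - (z + - x)              ≈⟨ +-congˡ (-1*x≈-x _) ⟨
    x + - 1# * (z + - x)         ∎
    where
    d : Carrier
    d = x + - z

module AffineMaps (F : FiniteField) where
  open FiniteField F using (Carrier; _+_; _*_; -_; 0#; 1#; _≟_; ≈⇒≡; reflexive; *-identityˡ; commRing)
  open RingIdentities commRing

  affine : ∀ {n} → Word F n → Word F n → Carrier → Word F n → Word F n
  affine p q μ z = _⊕_ F q (scale F μ (_⊖_ F z p))

  reflect : ∀ {n} → Word F n → Word F n → Word F n
  reflect x = affine x x (- 1#)

  Invertible : Carrier → Set
  Invertible μ = Σ Carrier λ μ' → μ * μ' ≡ 1#

  one-invertible : Invertible 1#
  one-invertible = 1# , ≈⇒≡ (*-identityˡ 1#)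

  minus-one-invertible : Invertible (- 1#)
  minus-one-invertible = - 1# , ≈⇒≡ minus-one-squared

  affine-sends-centre : ∀ {n} (p q : Word F n) μ → affine p q μ p ≡ q
  affine-sends-centre [] [] μ = refl
  affine-sends-centre (p ∷ ps) (q ∷ qs) μ =
    cong₂ _∷_ (≈⇒≡ (affine-sends p q μ)) (affine-sends-centre ps qs μ)

  affine-difference-word : ∀ {n} (p q : Word F n) μ a b →
    _⊖_ F (affine p q μ a) (affine p q μ b) ≡ scale F μ (_⊖_ F a b)
  affine-difference-word [] [] μ [] [] = refl
  affine-difference-word (p ∷ ps) (q ∷ qs) μ (a ∷ as) (b ∷ bs) =
    cong₂ _∷_ (≈⇒≡ (affine-difference p q μ a b)) (affine-difference-word ps qs μ as bs)

  scale-by-inverse : ∀ {n μ μ'} → μ * μ' ≡ 1# → (w : Word F n) → scale F μ' (scale F μ w) ≡ w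
  scale-by-inverse μμ'≡1 [] = refl
  scale-by-inverse μμ'≡1 (w ∷ ws) =
    cong₂ _∷_ (≈⇒≡ (cancel-unit (reflexive μμ'≡1) w)) (scale-by-inverse μμ'≡1 ws)

  affine-isometry : ∀ {n μ} → Invertible μ → (p q a b : Word F n) →
    dist F (affine p q μ a) (affine p q μ b) ≡ dist F a b
  affine-isometry μ-inv [] [] [] [] = refl
  affine-isometry {μ = μ} μ-inv@(_ , μμ'≡1) (p ∷ ps) (q ∷ qs) (a ∷ as) (b ∷ bs)
    with a ≟ b | (q + μ * (a + - p)) ≟ (q + μ * (b + - p))
  ... | yes _   | yes _       = affine-isometry μ-inv ps qs as bs
  ... | no _    | no _        = cong suc (affine-isometry μ-inv ps qs as bs)
  ... | yes a≡b | no images≢  = ⊥-elim (images≢ (cong (λ z → q + μ * (z + - p)) a≡b))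
  ... | no a≢b  | yes images≡ =
    ⊥-elim (a≢b (≈⇒≡ (affine-injective (reflexive μμ'≡1) p q a b (reflexive images≡))))

  translations-commute-word : ∀ {n} (x y t : Word F n) → affine x t 1# y ≡ affine x y 1# t
  translations-commute-word [] [] [] = refl
  translations-commute-word (x ∷ xs) (y ∷ ys) (t ∷ ts) =
    cong₂ _∷_ (≈⇒≡ (translations-commute x y t)) (translations-commute-word xs ys ts)

  characteristic-two-swap-word : two ≡ 0# → ∀ {n} (x y : Word F n) → affine x y 1# y ≡ x
  characteristic-two-swap-word two≡0 [] [] = refl
  characteristic-two-swap-word two≡0 (x ∷ xs) (y ∷ ys) =
    cong₂ _∷_ (≈⇒≡ (characteristic-two-swap (reflexive two≡0) x y))
              (characteristic-two-swap-word two≡0 xs ys)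

  reflect-involutive : ∀ {n} (x y : Word F n) → reflect x (reflect x y) ≡ y
  reflect-involutive [] [] = refl
  reflect-involutive (x ∷ xs) (y ∷ ys) =
    cong₂ _∷_ (≈⇒≡ (reflection-involutive x y)) (reflect-involutive xs ys)

  homothety-two-word : ∀ {n} (x z : Word F n) → affine z z two x ≡ reflect x z
  homothety-two-word [] [] = refl
  homothety-two-word (x ∷ xs) (z ∷ zs) =
    cong₂ _∷_ (≈⇒≡ (homothety-two x z)) (homothety-two-word xs zs)

module QuotientIsomorphism (F : FiniteField) {n : ℕ} (C : LinearCode F n) {m k : ℕ}
  (iso : QuotientIsoDoob F C m k) where
  open FiniteField F using (-_; 1#; commRing)
  open RingIdentities commRing using (two)
  open LinearCode C
  open AffineMaps F
  open Equivalence

  f : Word F n → DoobVertex m k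
  f = proj₁ iso

  same-vertex⇔same-coset : ∀ x y → (f x ≡ f y) ⇔ (_⊖_ F x y ∈C)
  same-vertex⇔same-coset = proj₁ (proj₂ iso)

  f-surjective : ∀ v → ∃ λ x → f x ≡ v
  f-surjective = proj₁ (proj₂ (proj₂ iso))

  adjacent⇔cosets-adjacent : ∀ x y → DoobAdj (f x) (f y) ⇔
    ((¬ (_⊖_ F x y ∈C)) ×
     (Σ (Word F n) λ x' → Σ (Word F n) λ y' →
        (_⊖_ F x x' ∈C) × (_⊖_ F y y' ∈C) × HAdj F x' y'))
  adjacent⇔cosets-adjacent = proj₂ (proj₂ (proj₂ iso))

  affine-preserves-cosets : ∀ p q μ {a b} → _⊖_ F a b ∈C →
    _⊖_ F (affine p q μ a) (affine p q μ b) ∈C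
  affine-preserves-cosets p q μ {a} {b} a-b∈C =
    subst _∈C (sym (affine-difference-word p q μ a b)) (·∈C μ a-b∈C)

  affine-reflects-cosets : ∀ {μ} → Invertible μ → ∀ p q {a b} →
    _⊖_ F (affine p q μ a) (affine p q μ b) ∈C → _⊖_ F a b ∈C
  affine-reflects-cosets {μ} (μ' , μμ'≡1) p q {a} {b} images∈C =
    subst _∈C (trans (cong (scale F μ') (affine-difference-word p q μ a b))
                     (scale-by-inverse μμ'≡1 (_⊖_ F a b)))
          (·∈C μ' images∈C)

  affine-respects-vertices : ∀ p q μ {a b} → f a ≡ f b →
    f (affine p q μ a) ≡ f (affine p q μ b)
  affine-respects-vertices p q μ {a} {b} fa≡fb =
    from (same-vertex⇔same-coset _ _)
         (affine-preserves-cosets p q μ (to (same-vertex⇔same-coset a b) fa≡fb))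

  reflect-reflects-vertices : ∀ x {a b} → f (reflect x a) ≡ f (reflect x b) → f a ≡ f b
  reflect-reflects-vertices x {a} {b} e =
    subst₂ _≡_ (cong f (reflect-involutive x a)) (cong f (reflect-involutive x b))
           (affine-respects-vertices x x (- 1#) e)

  affine-preserves-adjacency : ∀ {μ} → Invertible μ → ∀ p q {a b} →
    DoobAdj (f a) (f b) → DoobAdj (f (affine p q μ a)) (f (affine p q μ b))
  affine-preserves-adjacency {μ} μ-inv p q {a} {b} fa~fb
    with to (adjacent⇔cosets-adjacent a b) fa~fb
  ... | a≁b , a' , b' , a-a'∈C , b-b'∈C , a'~b' =
    from (adjacent⇔cosets-adjacent _ _)
      ( (λ images∈C → a≁b (affine-reflects-cosets μ-inv p q images∈C))
      , affine p q μ a' , affine p q μ b'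
      , affine-preserves-cosets p q μ a-a'∈C
      , affine-preserves-cosets p q μ b-b'∈C
      , trans (affine-isometry μ-inv p q a' b') a'~b' )

  translate-neighbour : ∀ {x y} → DoobAdj (f x) (f y) → ∀ t →
    DoobAdj (f t) (f (affine x y 1# t))
  translate-neighbour {x} {y} fx~fy t =
    subst₂ DoobAdj (cong f (affine-sends-centre x t 1#))
                   (cong f (translations-commute-word x y t))
           (affine-preserves-adjacency one-invertible x t fx~fy)

  -- if 2 is invertible, every neighbour z of a is adjacent to its reflection in a;
  -- the homothety with centre z and ratio 2 maps a to that reflection
  reflection-neighbour : Invertible two → ∀ {z a} → DoobAdj (f z) (f a) →
    DoobAdj (f z) (f (reflect a z))
  reflection-neighbour two-inv {z} {a} fz~fa =
    subst₂ DoobAdj (cong f (affine-sends-centre z z two))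
                   (cong f (homothety-two-word a z))
           (affine-preserves-adjacency two-inv z z fz~fa)

module NoDoobQuotient (F : FiniteField) {n : ℕ} (C : LinearCode F n) {m k : ℕ}
  (iso : QuotientIsoDoob F C (suc m) k) where
  open FiniteField F using (-_; 0#; 1#; _≟_; inverse; commRing)
  open RingIdentities commRing using (two)
  open AffineMaps F
  open QuotientIsomorphism F C iso

  point : ShrVertex → Word F n
  point h = proj₁ (f-surjective (axis h))

  point-image : ∀ h → f (point h) ≡ axis h
  point-image h = proj₂ (f-surjective (axis h))

  point-adjacent : ∀ {a b} → ShrAdj a b → DoobAdj (f (point a)) (f (point b))
  point-adjacent {a} {b} a~b =
    subst₂ DoobAdj (sym (point-image a)) (sym (point-image b)) (axis-adj a~b)

  common-neighbour-of-base : ∀ {v : DoobVertex (suc m) k} →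
    DoobAdj (axis s₀) v → DoobAdj (axis s₁) v →
    Σ ShrVertex λ h → v ≡ axis h × EdgeCommon h
  common-neighbour-of-base {v} = common-neighbour-on-axis base-edge v

  module CharacteristicTwo (two≡0 : two ≡ 0#) where
    τ : Word F n → Word F n
    τ = affine (point s₀) (point s₁) 1#

    τ-adjacency : ∀ {a b} → DoobAdj (f a) (f b) → DoobAdj (f (τ a)) (f (τ b))
    τ-adjacency = affine-preserves-adjacency one-invertible (point s₀) (point s₁)

    τ-s₀ : f (τ (point s₀)) ≡ axis s₁
    τ-s₀ = trans (cong f (affine-sends-centre (point s₀) (point s₁) 1#)) (point-image s₁)

    τ-s₁ : f (τ (point s₁)) ≡ axis s₀
    τ-s₁ = trans (cong f (characteristic-two-swap-word two≡0 (point s₀) (point s₁)))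
                 (point-image s₀)

    translated-common-neighbour : ∀ c → EdgeCommon c →
      Σ ShrVertex λ h → EdgeCommon h × ShrAdj c h
    translated-common-neighbour c (s₀~c , s₁~c) =
      conclude (common-neighbour-of-base s₀~τc s₁~τc)
      where
      s₀~τc : DoobAdj (axis s₀) (f (τ (point c)))
      s₀~τc = subst₂ DoobAdj τ-s₁ refl (τ-adjacency (point-adjacent s₁~c))
      s₁~τc : DoobAdj (axis s₁) (f (τ (point c)))
      s₁~τc = subst₂ DoobAdj τ-s₀ refl (τ-adjacency (point-adjacent s₀~c))
      conclude : Σ ShrVertex (λ h → f (τ (point c)) ≡ axis h × EdgeCommon h) →
        Σ ShrVertex λ h → EdgeCommon h × ShrAdj c h
      conclude (h , τc≡h , h-common) =
        h , h-common ,
        axis-adj⁻¹ (subst₂ DoobAdj (point-image c) τc≡h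
                     (translate-neighbour (point-adjacent base-edge) (point c)))

    impossible : ⊥
    impossible =
      let (c , c-common) = some-edge-common
          (h , h-common , c~h) = translated-common-neighbour c c-common
      in edge-common-independent c h c-common h-common c~h

  -- In odd characteristic the reflection ρ in point s₀ fixes s₀ and maps every
  -- neighbour to an adjacent vertex; so ρ s₁ is a common neighbour w, and for a
  -- pivot g of w the vertex ρ g is a common neighbour adjacent to g, hence equal
  -- to w = ρ s₁, forcing g = s₁.
  module OddCharacteristic (two-inv : Invertible two) where
    ρ : Word F n → Word F n
    ρ = reflect (point s₀)

    ρ-adjacency : ∀ {a b} → DoobAdj (f a) (f b) → DoobAdj (f (ρ a)) (f (ρ b))
    ρ-adjacency = affine-preserves-adjacency minus-one-invertible (point s₀) (point s₀)

    ρ-s₀ : f (ρ (point s₀)) ≡ axis s₀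
    ρ-s₀ = trans (cong f (affine-sends-centre (point s₀) (point s₀) (- 1#))) (point-image s₀)

    reflected-neighbour : ∀ {g} → ShrAdj s₀ g → ShrAdj g s₀ →
      DoobAdj (axis s₀) (f (ρ (point g))) × DoobAdj (axis g) (f (ρ (point g)))
    reflected-neighbour {g} s₀~g g~s₀ =
      subst₂ DoobAdj ρ-s₀ refl (ρ-adjacency (point-adjacent s₀~g)) ,
      subst₂ DoobAdj (point-image g) refl (reflection-neighbour two-inv (point-adjacent g~s₀))

    pivot-is-s₁ : ∀ {w} → f (ρ (point s₁)) ≡ axis w → Pivot w → ⊥
    pivot-is-s₁ {w} ρs₁≡w (g , s₀~g , g~s₀ , w~g , g≢s₁ , unique) =
      conclude (common-neighbour-of-base (proj₁ (reflected-neighbour s₀~g g~s₀)) s₁~ρg)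
      where
      open ≡-Reasoning
      s₁~ρg : DoobAdj (axis s₁) (f (ρ (point g)))
      s₁~ρg = subst₂ DoobAdj
        (trans (cong f (reflect-involutive (point s₀) (point s₁))) (point-image s₁)) refl
        (ρ-adjacency (subst₂ DoobAdj (sym ρs₁≡w) (sym (point-image g)) (axis-adj w~g)))
      conclude : Σ ShrVertex (λ h → f (ρ (point g)) ≡ axis h × EdgeCommon h) → ⊥
      conclude (w' , ρg≡w' , w'-common) = g≢s₁ (axis-injective (begin
        axis g        ≡⟨ point-image g ⟨
        f (point g)   ≡⟨ reflect-reflects-vertices (point s₀) ρg≡ρs₁ ⟩
        f (point s₁)  ≡⟨ point-image s₁ ⟩
        axis s₁       ∎))
        where
        w'≡w : w' ≡ w
        w'≡w = unique w' w'-common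
          (axis-adj⁻¹ (subst₂ DoobAdj refl ρg≡w' (proj₂ (reflected-neighbour s₀~g g~s₀))))
        ρg≡ρs₁ : f (ρ (point g)) ≡ f (ρ (point s₁))
        ρg≡ρs₁ = trans ρg≡w' (trans (cong axis w'≡w) (sym ρs₁≡w))

    reflected-s₁ : Σ ShrVertex λ w → f (ρ (point s₁)) ≡ axis w × EdgeCommon w
    reflected-s₁ = common-neighbour-of-base
      (subst₂ DoobAdj ρ-s₀ refl (ρ-adjacency (point-adjacent base-edge)))
      (subst₂ DoobAdj (point-image s₁) refl
              (reflection-neighbour two-inv (point-adjacent base-edge⁻¹)))

    impossible : ⊥
    impossible =
      let (w , ρs₁≡w , w-common) = reflected-s₁
      in pivot-is-s₁ ρs₁≡w (pivot w w-common)

  impossible : ⊥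
  impossible with two ≟ 0#
  ... | yes two≡0 = CharacteristicTwo.impossible two≡0
  ... | no two≢0  = OddCharacteristic.impossible (inverse two two≢0)

proposition3p13 : (F : FiniteField) (n : ℕ) (C : LinearCode F n) →
    CompletelyRegular F C →
    (m k : ℕ) → 1 ≤ m → ¬ QuotientIsoDoob F C m k
proposition3p13 F n C _ (suc m) k (s≤s _) iso = NoDoobQuotient.impossible F C iso
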